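{- Let $I$ be an interval. Then inclusion is a total order on $\mathcal{B}_R(I)$ (for all $I',I''\in\mathcal{B}_R(I)$, $I'\subseteq I''$ or $I''\subseteq I'$), and for every MTL context $C$, all MTL formulae $\phi,\phi'$, and all $I',I''\in\mathcal{B}_R(I)$ with $I''\supseteq I'$, we have $C[\phi\,\mathcal{U}_{I'}\,\phi'] \sqsubseteq C[\phi\,\mathcal{U}_{I''}\,\phi']$.
   Context: An interval is $I=[a,b]$ with $a\in\mathbb{N}$, $b\in\mathbb{N}\cup\{\infty\}$, $a\le b$, viewed as a set of naturals. For $I=[a,b]$, $\mathcal{B}_R(I)$ (right-bound modifications of $I$) is the set of all intervals $[a,b+i]$ for $i\in\mathbb{N}$ together with all $[a,b-i]$ for $i\in\mathbb{N}$, $i\le b-a$ (with $\infty\pm i=\infty$). MTL formulae over propositions $\mathcal{P}$: $\phi ::= p \mid \top \mid \neg\phi \mid \phi\land\phi \mid \phi\,\mathcal{U}_I\,\phi \mid \phi\,\mathcal{R}_I\,\phi$, with $\phi_1\lor\phi_2:=\neg(\neg\phi_1\land\neg\phi_2)$. Traces $\pi$ are infinite sequences of subsets of $\mathcal{P}$; $\pi,t\vDash p$ iff $p\in\pi(t)$; $\neg,\land,\top$ as usual; $\pi,t\vDash\phi_1\,\mathcal{U}_I\,\phi_2$ iff there is $i\in I$ with $\pi,t+i\vDash\phi_2$ and $\pi,t+j\vDash\phi_1$ for all $j\in[0,i)\cap I$; $\phi_1\,\mathcal{R}_I\,\phi_2$ means $\neg(\neg\phi_1\,\mathcal{U}_I\,\neg\phi_2)$.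 $\phi\sqsubseteq\phi'$ iff for all traces $\pi$ and $t\in\mathbb{N}$, $\pi,t\vDash\phi$ implies $\pi,t\vDash\phi'$. MTL contexts: $C ::= [-] \mid C\land\phi \mid \phi\land C \mid C\lor\phi \mid \phi\lor C \mid C\,\mathcal{U}_I\,\phi \mid \phi\,\mathcal{U}_I\,C \mid C\,\mathcal{R}_I\,\phi \mid \phi\,\mathcal{R}_I\,C$ ($\phi$ an MTL formula, $I$ an interval); $C[\psi]$ is the formula obtained by replacing the unique hole $[-]$ by $\psi$. -}

module Defs where

open import Data.Nat using (ℕ; zero; suc; _+_; _∸_; _≤_; _<_)
open import Data.Product using (Σ; _×_; _,_)
open import Data.Sum using (_⊎_)
open import Data.Empty using (⊥)
open import Data.Unit using (⊤)
open import Relation.Nullary using (¬_)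
open import Relation.Binary.PropositionalEquality using (_≡_)

data Bound : Set where
  fin : ℕ → Bound
  ∞   : Bound

_+ᴮ_ : Bound → ℕ → Bound
fin b +ᴮ i = fin (b + i)
∞     +ᴮ i = ∞

_∸ᴮ_ : Bound → ℕ → Bound
fin b ∸ᴮ i = fin (b ∸ i)
∞     ∸ᴮ i = ∞

data _≤ᴮ_ : Bound → Bound → Set where
  fin≤fin : ∀ {m n} → m ≤ n → fin m ≤ᴮ fin n
  ≤∞      : ∀ {b} → b ≤ᴮ ∞

record Interval : Set where
  constructor [_,_]⟨_⟩
  field
    lo    : ℕ
    hi    : Bound
    lo≤hi : fin lo ≤ᴮ hi
open Interval public

_∈ᴵ_ : ℕ → Interval → Set
n ∈ᴵ I = (lo I ≤ n) × (fin n ≤ᴮ hi I)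

_⊆ᴵ_ : Interval → Interval → Set
I ⊆ᴵ J = ∀ n → n ∈ᴵ I → n ∈ᴵ J

-- J ∈ 𝓑_R(I): J = [a, b+i] for some i ∈ ℕ, or J = [a, b-i] for some i ≤ b - a.
InBR : Interval → Interval → Set
InBR I J =
  (lo J ≡ lo I) ×
  ((Σ ℕ λ i → hi J ≡ hi I +ᴮ i)
   ⊎ (Σ ℕ λ i → (fin i ≤ᴮ (hi I ∸ᴮ lo I)) × (hi J ≡ hi I ∸ᴮ i)))

data Form (P : Set) : Set where
  atom : P → Form P
  tt   : Form P
  ¬ᶠ_  : Form P → Form P
  _∧ᶠ_ : Form P → Form P → Form P
  _U[_]_ : Form P → Interval → Form P → Form P
  _R[_]_ : Form P → Interval → Form P → Form P

_∨ᶠ_ : {P : Set} → Form P → Form P → Form P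
φ ∨ᶠ ψ = ¬ᶠ ((¬ᶠ φ) ∧ᶠ (¬ᶠ ψ))

Trace : Set → Set₁
Trace P = ℕ → P → Set

_,_⊨_ : {P : Set} → Trace P → ℕ → Form P → Set
π , t ⊨ atom p = π t p
π , t ⊨ tt = ⊤
π , t ⊨ (¬ᶠ φ) = ¬ (π , t ⊨ φ)
π , t ⊨ (φ ∧ᶠ ψ) = (π , t ⊨ φ) × (π , t ⊨ ψ)
π , t ⊨ (φ U[ I ] ψ) =
  Σ ℕ λ i → (i ∈ᴵ I) × (π , (t + i) ⊨ ψ) ×
            (∀ j → j < i → j ∈ᴵ I → π , (t + j) ⊨ φ)
-- φ R_I ψ := ¬(¬φ U_I ¬ψ), unfolded (literally) for structural recursion
π , t ⊨ (φ R[ I ] ψ) =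
  ¬ (Σ ℕ λ i → (i ∈ᴵ I) × ¬ (π , (t + i) ⊨ ψ) ×
               (∀ j → j < i → j ∈ᴵ I → ¬ (π , (t + j) ⊨ φ)))

_⊑_ : {P : Set} → Form P → Form P → Set₁
_⊑_ {P} φ ψ = (π : Trace P) (t : ℕ) → π , t ⊨ φ → π , t ⊨ ψ

data Ctx (P : Set) : Set where
  hole : Ctx P
  _∧ˡ_ : Ctx P → Form P → Ctx P
  _∧ʳ_ : Form P → Ctx P → Ctx P
  _∨ˡ_ : Ctx P → Form P → Ctx P
  _∨ʳ_ : Form P → Ctx P → Ctx P
  _Uˡ[_]_ : Ctx P → Interval → Form P → Ctx P
  _Uʳ[_]_ : Form P → Interval → Ctx P → Ctx P
  _Rˡ[_]_ : Ctx P → Interval → Form P → Ctx P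
  _Rʳ[_]_ : Form P → Interval → Ctx P → Ctx P

plug : {P : Set} → Ctx P → Form P → Form P
plug hole ψ = ψ
plug (C ∧ˡ φ) ψ = plug C ψ ∧ᶠ φ
plug (φ ∧ʳ C) ψ = φ ∧ᶠ plug C ψ
plug (C ∨ˡ φ) ψ = plug C ψ ∨ᶠ φ
plug (φ ∨ʳ C) ψ = φ ∨ᶠ plug C ψ
plug (C Uˡ[ I ] φ) ψ = plug C ψ U[ I ] φ
plug (φ Uʳ[ I ] C) ψ = φ U[ I ] plug C ψ
plug (C Rˡ[ I ] φ) ψ = plug C ψ R[ I ] φ
plug (φ Rʳ[ I ] C) ψ = φ R[ I ] plug C ψ

{-# OPTIONS --safe #-}
-- Every interval in 𝓑_R(I) has the lower bound of I, so these intervals are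
-- ordered by their right bounds, which are totally ordered. Enlarging the right
-- bound of an until keeps its witness i admissible and does not add obligations
-- for the left argument, since those only concern positions in [lo, i).
-- Contexts contain no negation of the hole (∨ and R negate twice), so every
-- context is monotone with respect to ⊑.
module Submission where

open import Defs
open import Data.Product using (_×_; _,_)
open import Data.Sum using (_⊎_; inj₁; inj₂)
open import Data.Nat using (_+_; _≤_)
open import Data.Nat.Properties using (≤-total; ≤-trans; <⇒≤)
open import Relation.Binary.PropositionalEquality using (_≡_; sym; trans; subst)

≤ᴮ-trans : ∀ {a b c} → a ≤ᴮ b → b ≤ᴮ c → a ≤ᴮ c
≤ᴮ-trans (fin≤fin p) (fin≤fin q) = fin≤fin (≤-trans p q)
≤ᴮ-trans _           ≤∞          = ≤∞

≤ᴮ-total : ∀ a b → a ≤ᴮ b ⊎ b ≤ᴮ a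
≤ᴮ-total (fin m) (fin n) with ≤-total m n
... | inj₁ m≤n = inj₁ (fin≤fin m≤n)
... | inj₂ n≤m = inj₂ (fin≤fin n≤m)
≤ᴮ-total _       ∞       = inj₁ ≤∞
≤ᴮ-total ∞       (fin n) = inj₂ ≤∞

⊆ᴵ-of-hi : ∀ {I J} → lo I ≡ lo J → hi I ≤ᴮ hi J → I ⊆ᴵ J
⊆ᴵ-of-hi lo≡ hi≤ n (lo≤n , n≤hi) = subst (_≤ n) lo≡ lo≤n , ≤ᴮ-trans n≤hi hi≤

⊆ᴵ-total : ∀ I J → lo I ≡ lo J → I ⊆ᴵ J ⊎ J ⊆ᴵ I
⊆ᴵ-total I J lo≡ with ≤ᴮ-total (hi I) (hi J)
... | inj₁ hiI≤hiJ = inj₁ (⊆ᴵ-of-hi {I} {J} lo≡ hiI≤hiJ)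
... | inj₂ hiJ≤hiI = inj₂ (⊆ᴵ-of-hi {J} {I} (sym lo≡) hiJ≤hiI)

InBR-lo≡ : ∀ I J K → InBR I J → InBR I K → lo J ≡ lo K
InBR-lo≡ _ _ _ (loJ≡loI , _) (loK≡loI , _) = trans loJ≡loI (sym loK≡loI)

module _ {P : Set} where

  -- ⊑ is a function, so Agda cannot infer formulas from it; this record can.
  record _≼_ (φ ψ : Form P) : Set₁ where
    constructor ⟪_⟫
    field ≼⇒⊑ : φ ⊑ ψ
  open _≼_ public

  ≼-refl : {φ : Form P} → φ ≼ φ
  ≼-refl = ⟪ (λ π t ⊨φ → ⊨φ) ⟫

  ¬ᶠ-antitone : {φ φ′ : Form P} → φ ≼ φ′ → (¬ᶠ φ′) ≼ (¬ᶠ φ)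
  ¬ᶠ-antitone ⟪ φ⊑φ′ ⟫ = ⟪ (λ π t ⊭φ′ ⊨φ → ⊭φ′ (φ⊑φ′ π t ⊨φ)) ⟫

  ∧ᶠ-mono : {φ φ′ ψ ψ′ : Form P} → φ ≼ φ′ → ψ ≼ ψ′ → (φ ∧ᶠ ψ) ≼ (φ′ ∧ᶠ ψ′)
  ∧ᶠ-mono ⟪ φ⊑φ′ ⟫ ⟪ ψ⊑ψ′ ⟫ = ⟪ (λ π t (⊨φ , ⊨ψ) → φ⊑φ′ π t ⊨φ , ψ⊑ψ′ π t ⊨ψ) ⟫

  ∨ᶠ-mono : {φ φ′ ψ ψ′ : Form P} → φ ≼ φ′ → ψ ≼ ψ′ → (φ ∨ᶠ ψ) ≼ (φ′ ∨ᶠ ψ′)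
  ∨ᶠ-mono φ≼φ′ ψ≼ψ′ = ¬ᶠ-antitone (∧ᶠ-mono (¬ᶠ-antitone φ≼φ′) (¬ᶠ-antitone ψ≼ψ′))

  U-mono : {φ φ′ ψ ψ′ : Form P} {I : Interval} →
           φ ≼ φ′ → ψ ≼ ψ′ → (φ U[ I ] ψ) ≼ (φ′ U[ I ] ψ′)
  U-mono ⟪ φ⊑φ′ ⟫ ⟪ ψ⊑ψ′ ⟫ = ⟪ (λ π t (i , i∈I , ⊨ψ , ⊨φ-before) →
    i , i∈I , ψ⊑ψ′ π (t + i) ⊨ψ ,
    λ j j<i j∈I → φ⊑φ′ π (t + j) (⊨φ-before j j<i j∈I)) ⟫

  -- The semantics of φ R[ I ] ψ is definitionally that of ¬ᶠ (¬ᶠ φ U[ I ] ¬ᶠ ψ).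
  R-mono : {φ φ′ ψ ψ′ : Form P} {I : Interval} →
           φ ≼ φ′ → ψ ≼ ψ′ → (φ R[ I ] ψ) ≼ (φ′ R[ I ] ψ′)
  R-mono {I = I} φ≼φ′ ψ≼ψ′ =
    ⟪ ≼⇒⊑ (¬ᶠ-antitone (U-mono {I = I} (¬ᶠ-antitone φ≼φ′) (¬ᶠ-antitone ψ≼ψ′))) ⟫

  plug-mono : (C : Ctx P) {ψ ψ′ : Form P} → ψ ≼ ψ′ → plug C ψ ≼ plug C ψ′
  plug-mono hole          ψ≼ψ′ = ψ≼ψ′
  plug-mono (C ∧ˡ φ)      ψ≼ψ′ = ∧ᶠ-mono (plug-mono C ψ≼ψ′) ≼-refl
  plug-mono (φ ∧ʳ C)      ψ≼ψ′ = ∧ᶠ-mono ≼-refl (plug-mono C ψ≼ψ′)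
  plug-mono (C ∨ˡ φ)      ψ≼ψ′ = ∨ᶠ-mono (plug-mono C ψ≼ψ′) ≼-refl
  plug-mono (φ ∨ʳ C)      ψ≼ψ′ = ∨ᶠ-mono ≼-refl (plug-mono C ψ≼ψ′)
  plug-mono (C Uˡ[ I ] φ) ψ≼ψ′ = U-mono (plug-mono C ψ≼ψ′) ≼-refl
  plug-mono (φ Uʳ[ I ] C) ψ≼ψ′ = U-mono ≼-refl (plug-mono C ψ≼ψ′)
  plug-mono (C Rˡ[ I ] φ) ψ≼ψ′ = R-mono (plug-mono C ψ≼ψ′) ≼-refl
  plug-mono (φ Rʳ[ I ] C) ψ≼ψ′ = R-mono ≼-refl (plug-mono C ψ≼ψ′)

  U-mono-⊆ᴵ : {φ ψ : Form P} (I J : Interval) →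
              lo J ≡ lo I → I ⊆ᴵ J → (φ U[ I ] ψ) ≼ (φ U[ J ] ψ)
  U-mono-⊆ᴵ _ _ loJ≡loI I⊆J = ⟪ (λ π t (i , i∈I@(_ , i≤hiI) , ⊨ψ , ⊨φ-before) →
    i , I⊆J i i∈I , ⊨ψ ,
    λ j j<i (loJ≤j , _) → ⊨φ-before j j<i
      (subst (_≤ j) loJ≡loI loJ≤j , ≤ᴮ-trans (fin≤fin (<⇒≤ j<i)) i≤hiI)) ⟫

lemma3 : {P : Set} (I : Interval) →
    ((I′ I″ : Interval) → InBR I I′ → InBR I I″ → (I′ ⊆ᴵ I″) ⊎ (I″ ⊆ᴵ I′))
    × ((C : Ctx P) (φ φ′ : Form P) (I′ I″ : Interval) →
        InBR I I′ → InBR I I″ → I′ ⊆ᴵ I″ →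
        plug C (φ U[ I′ ] φ′) ⊑ plug C (φ U[ I″ ] φ′))
lemma3 I =
  (λ I′ I″ I′∈BR I″∈BR → ⊆ᴵ-total I′ I″ (InBR-lo≡ I I′ I″ I′∈BR I″∈BR)) ,
  (λ C φ φ′ I′ I″ I′∈BR I″∈BR I′⊆I″ →
     ≼⇒⊑ (plug-mono C (U-mono-⊆ᴵ I′ I″ (InBR-lo≡ I I″ I′ I″∈BR I′∈BR) I′⊆I″)))
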